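{- Let $A$ be an $m\times n$ $(0,1)$-matrix. Then the sequence $\rho_0(A),\rho_1(A),\rho_2(A),\ldots$ satisfies \[\rho_k(A)-\rho_{k-1}(A)\ge \rho_{k+1}(A)-\rho_k(A)\quad (k\ge 1).\]
   Context: For a $(0,1)$-matrix $A$ and positive integer $t$, the $t$-term rank $\rho_t(A)$ is the maximum number of $1$s of $A$ that can be chosen with at most one chosen $1$ in each column and at most $t$ chosen $1$s in each row. By convention $\rho_0(A)=0$. -}

module Defs where

open import Data.Nat using (ℕ; zero; suc; _+_; _≤_)
open import Data.Bool using (Bool; true)
open import Data.Fin using (Fin; _≟_)
open import Data.Maybe using (Maybe; just; nothing)
open import Data.Product using (Σ; _×_)
open import Relation.Binary.PropositionalEquality using (_≡_)
open import Relation.Nullary using (does)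

Matrix01 : ℕ → ℕ → Set
Matrix01 m n = Fin m → Fin n → Bool

count : ∀ {n} → (Fin n → Bool) → ℕ
count {zero}  f = 0
count {suc n} f with f Fin.zero
... | true  = suc (count {n} (λ j → f (Fin.suc j)))
... | _     = count {n} (λ j → f (Fin.suc j))

-- A choice of 1s with at most one chosen 1 per column: for each column j,
-- either no entry is chosen (nothing) or the entry in row i is chosen (just i).
Choice : ℕ → ℕ → Set
Choice m n = Fin n → Maybe (Fin m)

ChoosesOnes : ∀ {m n} → Matrix01 m n → Choice m n → Set
ChoosesOnes {m} {n} A c = ∀ (j : Fin n) (i : Fin m) → c j ≡ just i → A i j ≡ true

isChosenIn : ∀ {m} → Fin m → Maybe (Fin m) → Bool
isChosenIn i nothing  = Data.Bool.false
isChosenIn i (just k) = does (i ≟ k)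

rowCount : ∀ {m n} → Choice m n → Fin m → ℕ
rowCount c i = count (λ j → isChosenIn i (c j))

size : ∀ {m n} → Choice m n → ℕ
size c = count (λ j → isChosenIn' (c j))
  where
  isChosenIn' : ∀ {m} → Maybe (Fin m) → Bool
  isChosenIn' nothing  = Data.Bool.false
  isChosenIn' (just _) = true

ValidChoice : ∀ {m n} → ℕ → Matrix01 m n → Choice m n → Set
ValidChoice t A c = ChoosesOnes A c × (∀ i → rowCount c i ≤ t)

-- r is the t-term rank ρ_t(A): the maximum size of a valid choice.
-- (For t = 0 this forces r = 0, agreeing with the convention ρ_0(A) = 0.)
IsTermRank : ∀ {m n} → ℕ → Matrix01 m n → ℕ → Set
IsTermRank t A r =
  Σ _ (λ c → ValidChoice t A c × size c ≡ r) × (∀ c → ValidChoice t A c → size c ≤ r)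

-- Read column j as an edge {P j, Q j} between rows. Every such multigraph has a balanced
-- orientation, in which each row is a tail and a head equally often up to one: split off
-- two edges sharing an endpoint u into a single edge, orient the smaller graph by induction,
-- and route the new edge back through u. For optimal choices P for ρ_k and Q for ρ_{k+2},
-- the tails R and heads S then have at most k+1 ones per row (together at most 2k+2, differing
-- by at most one) and |R| + |S| = |P| + |Q|, so ρ_k + ρ_{k+2} ≤ 2 ρ_{k+1}.
module Submission where

open import Defs
open import Data.Nat using (ℕ; suc)
open import Data.Integer using (+_; _-_; _≤_; _⊖_)

open import Data.Bool using (Bool; true; false; not; _xor_)
open import Data.Empty using (⊥-elim)
open import Data.Fin using (Fin; zero; suc; _≟_; punchIn)
open import Data.Fin.Properties using (any?; punchInᵢ≢i; suc-injective; 0≢1+n)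
import Data.Integer.Properties as ℤₚ
open import Data.Maybe using (Maybe; just; nothing)
open import Data.Maybe.Properties using (≡-dec)
open import Data.Nat as ℕ using (zero; _+_; _<_; z≤n; s≤s)
open import Data.Nat.Induction using (<-wellFounded)
import Data.Nat.Properties as ℕₚ
open import Algebra.Properties.CommutativeMonoid.Sum ℕₚ.+-0-commutativeMonoid
  using (sum; sum-cong-≗; ∑-distrib-+; sum-remove)
open import Data.Nat.Tactic.RingSolver using (solve-∀)
open import Data.Product using (∃; ∃₂; _×_; _,_; proj₁; proj₂; swap)
open import Data.Sum using (_⊎_; inj₁; inj₂)
open import Data.Vec.Functional using (Vector; updateAt; removeAt; zip)
open import Data.Vec.Functional.Properties using (updateAt-updates; updateAt-minimal)
open import Function using (_∘_; const)
open import Induction.WellFounded using (Acc; acc)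
open import Relation.Binary.PropositionalEquality
open import Relation.Nullary using (Dec; yes; no; ¬_)
open import Relation.Nullary.Decidable using (_×-dec_; _⊎-dec_; ¬?)

private
  variable
    m n : ℕ

fromBool : Bool → ℕ
fromBool true  = 1
fromBool false = 0

count≡sum : (b : Fin n → Bool) → count b ≡ sum (fromBool ∘ b)
count≡sum {zero}  b = refl
count≡sum {suc n} b with b zero
... | true  = cong suc (count≡sum (b ∘ suc))
... | false = count≡sum (b ∘ suc)

count-none : (b : Fin n → Bool) → (∀ j → b j ≢ true) → count b ≡ 0
count-none {zero}  b none = refl
count-none {suc n} b none with b zero in eq
... | true  = ⊥-elim (none zero eq)
... | false = count-none (b ∘ suc) (none ∘ suc)

count-unique : (b : Fin n → Bool) → (∀ j₁ j₂ → b j₁ ≡ true → b j₂ ≡ true → j₁ ≡ j₂) →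
               count b ℕ.≤ 1
count-unique {zero}  b unique = z≤n
count-unique {suc n} b unique with b zero in eq
... | true  = ℕₚ.≤-reflexive (cong suc (count-none (b ∘ suc) λ j bj → 0≢1+n (unique zero (suc j) eq bj)))
... | false = count-unique (b ∘ suc) λ j₁ j₂ b₁ b₂ → suc-injective (unique (suc j₁) (suc j₂) b₁ b₂)

#just : ∀ {a} {A : Set a} → Maybe A → ℕ
#just nothing  = 0
#just (just _) = 1

size≡sum : (c : Choice m n) → size c ≡ sum (#just ∘ c)
size≡sum {n = zero}  c = refl
size≡sum {n = suc n} c with c zero
... | nothing = size≡sum (c ∘ suc)
... | just _  = cong suc (size≡sum (c ∘ suc))

hits : Fin m → Maybe (Fin m) → ℕ
hits i = fromBool ∘ isChosenIn i

rowSum : Choice m n → Fin m → ℕ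
rowSum c i = sum (hits i ∘ c)

rowCount≡rowSum : (c : Choice m n) (i : Fin m) → rowCount c i ≡ rowSum c i
rowCount≡rowSum c i = count≡sum (isChosenIn i ∘ c)

isChosenIn⇒≡just : (i : Fin m) (p : Maybe (Fin m)) → isChosenIn i p ≡ true → p ≡ just i
isChosenIn⇒≡just i (just k) chosen with i ≟ k
... | yes refl = refl

rowSum-unique : (c : Choice m n) (i : Fin m) →
                (∀ j₁ j₂ → c j₁ ≡ just i → c j₂ ≡ just i → j₁ ≡ j₂) → rowSum c i ℕ.≤ 1
rowSum-unique c i unique = subst (ℕ._≤ 1) (rowCount≡rowSum c i) (count-unique (isChosenIn i ∘ c)
  λ j₁ j₂ c₁ c₂ → unique j₁ j₂ (isChosenIn⇒≡just i _ c₁) (isChosenIn⇒≡just i _ c₂))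

sum-cong-off : (f g : Vector ℕ n) (j : Fin n) → (∀ k → k ≢ j → f k ≡ g k) →
               sum f + g j ≡ sum g + f j
sum-cong-off {suc n} f g j agree = begin
  sum f + g j                     ≡⟨ cong (_+ g j) (sum-remove {i = j} f) ⟩
  f j + sum (removeAt f j) + g j  ≡⟨ cong (λ r → f j + r + g j) rest ⟩
  f j + sum (removeAt g j) + g j  ≡⟨ exchange (f j) _ (g j) ⟩
  g j + sum (removeAt g j) + f j  ≡⟨ cong (_+ f j) (sum-remove {i = j} g) ⟨
  sum g + f j                     ∎
  where
  open ≡-Reasoning
  rest : sum (removeAt f j) ≡ sum (removeAt g j)
  rest = sum-cong-≗ λ k → agree (punchIn j k) (punchInᵢ≢i j k)
  exchange : ∀ x r y → x + r + y ≡ y + r + x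
  exchange = solve-∀

sum-cong-off₂ : (f g : Vector ℕ n) {j₁ j₂ : Fin n} → j₁ ≢ j₂ →
                (∀ k → k ≢ j₁ → k ≢ j₂ → f k ≡ g k) →
                sum f + (g j₁ + g j₂) ≡ sum g + (f j₁ + f j₂)
sum-cong-off₂ f g {j₁} {j₂} j₁≢j₂ agree = begin
  sum f + (g j₁ + g j₂)  ≡⟨ cong (λ x → sum f + (x + g j₂)) h₁ ⟨
  sum f + (h j₁ + g j₂)  ≡⟨ ℕₚ.+-assoc (sum f) _ _ ⟨
  sum f + h j₁ + g j₂    ≡⟨ cong (_+ g j₂) (sum-cong-off f h j₁ f≗h) ⟩
  sum h + f j₁ + g j₂    ≡⟨ right-comm (sum h) _ _ ⟩
  sum h + g j₂ + f j₁    ≡⟨ cong (_+ f j₁) (sum-cong-off h g j₂ h≗g) ⟩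
  sum g + h j₂ + f j₁    ≡⟨ cong (λ x → sum g + x + f j₁) h₂ ⟩
  sum g + f j₂ + f j₁    ≡⟨ right-comm (sum g) _ _ ⟩
  sum g + f j₁ + f j₂    ≡⟨ ℕₚ.+-assoc (sum g) _ _ ⟩
  sum g + (f j₁ + f j₂)  ∎
  where
  open ≡-Reasoning
  right-comm : ∀ x y z → x + y + z ≡ x + z + y
  right-comm = solve-∀
  h : Vector ℕ _
  h = updateAt f j₁ (const (g j₁))
  h₁ : h j₁ ≡ g j₁
  h₁ = updateAt-updates j₁ f
  h₂ : h j₂ ≡ f j₂
  h₂ = updateAt-minimal j₂ j₁ f (j₁≢j₂ ∘ sym)
  f≗h : ∀ k → k ≢ j₁ → f k ≡ h k
  f≗h k k≢j₁ = sym (updateAt-minimal k j₁ f k≢j₁)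
  h≗g : ∀ k → k ≢ j₂ → h k ≡ g k
  h≗g k k≢j₂ with k ≟ j₁
  ... | yes refl = h₁
  ... | no k≢j₁  = trans (updateAt-minimal k j₁ f k≢j₁) (agree k k≢j₁ k≢j₂)

sum-change₂ : (f g : Vector ℕ n) {j₁ j₂ : Fin n} (d : ℕ) → j₁ ≢ j₂ →
              (∀ k → k ≢ j₁ → k ≢ j₂ → f k ≡ g k) →
              f j₁ + f j₂ ≡ d + (g j₁ + g j₂) → sum f ≡ d + sum g
sum-change₂ f g {j₁} {j₂} d j₁≢j₂ agree local = ℕₚ.+-cancelʳ-≡ (g j₁ + g j₂) _ _ (begin
  sum f + (g j₁ + g j₂)        ≡⟨ sum-cong-off₂ f g j₁≢j₂ agree ⟩
  sum g + (f j₁ + f j₂)        ≡⟨ cong (λ x → sum g + x) local ⟩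
  sum g + (d + (g j₁ + g j₂))  ≡⟨ ℕₚ.+-assoc (sum g) d _ ⟨
  sum g + d + (g j₁ + g j₂)    ≡⟨ cong (_+ (g j₁ + g j₂)) (ℕₚ.+-comm (sum g) d) ⟩
  d + sum g + (g j₁ + g j₂)    ∎)
  where open ≡-Reasoning

update₂ : ∀ {a} {A : Set a} → Vector A n → Fin n → A → Fin n → A → Vector A n
update₂ v j₁ x j₂ y = updateAt (updateAt v j₁ (const x)) j₂ (const y)

module _ {a} {A : Set a} (v : Vector A n) {j₁ j₂ : Fin n} (x y : A) where

  update₂-updates₁ : j₁ ≢ j₂ → update₂ v j₁ x j₂ y j₁ ≡ x
  update₂-updates₁ j₁≢j₂ = trans (updateAt-minimal j₁ j₂ _ j₁≢j₂) (updateAt-updates j₁ v)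

  update₂-updates₂ : update₂ v j₁ x j₂ y j₂ ≡ y
  update₂-updates₂ = updateAt-updates j₂ _

  update₂-minimal : ∀ k → k ≢ j₁ → k ≢ j₂ → update₂ v j₁ x j₂ y k ≡ v k
  update₂-minimal k k≢j₁ k≢j₂ = trans (updateAt-minimal k j₂ _ k≢j₂) (updateAt-minimal k j₁ v k≢j₁)

-- Either end may be missing: a column used by only one of the two choices.
Edge : ℕ → Set
Edge m = Maybe (Fin m) × Maybe (Fin m)

orient : Bool → Edge m → Edge m
orient false e = e
orient true  e = swap e

orient-xor : ∀ τ s (e : Edge m) → orient s (orient τ e) ≡ orient (τ xor s) e
orient-xor false s     e = refl
orient-xor true  false e = refl
orient-xor true  true  e = refl

orient-not : ∀ s (e : Edge m) → orient (not s) e ≡ orient s (swap e)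
orient-not false e = refl
orient-not true  e = refl

orient-empty : ∀ s → orient {m} s (nothing , nothing) ≡ (nothing , nothing)
orient-empty false = refl
orient-empty true  = refl

oriented : (Fin n → Bool) → Vector (Edge m) n → Vector (Edge m) n
oriented σ E j = orient (σ j) (E j)

tails heads : Vector (Edge m) n → Choice m n
tails F = proj₁ ∘ F
heads F = proj₂ ∘ F

Balanced : Vector (Edge m) n → Set
Balanced F = ∀ i → rowSum (tails F) i ℕ.≤ suc (rowSum (heads F) i)
                 × rowSum (heads F) i ℕ.≤ suc (rowSum (tails F) i)

Balanced-reverse : {F : Vector (Edge m) n} → Balanced F → Balanced (swap ∘ F)
Balanced-reverse balanced = swap ∘ balanced

Incident : Fin m → Edge m → Set
Incident u e = proj₁ e ≡ just u ⊎ proj₂ e ≡ just u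

incident⇒orient : ∀ {u : Fin m} (e : Edge m) → Incident u e → ∃₂ λ τ a → orient τ e ≡ (just u , a)
incident⇒orient e (inj₁ tail≡u) = false , proj₂ e , cong (_, proj₂ e) tail≡u
incident⇒orient e (inj₂ head≡u) = true  , proj₁ e , cong (_, proj₁ e) head≡u

SharedEndpoint : Vector (Edge m) n → Set
SharedEndpoint {m} {n} E =
  ∃₂ λ (j₁ j₂ : Fin n) → j₁ ≢ j₂ × ∃ λ (u : Fin m) → Incident u (E j₁) × Incident u (E j₂)

sharedEndpoint? : (E : Vector (Edge m) n) → Dec (SharedEndpoint E)
sharedEndpoint? E = any? λ j₁ → any? λ j₂ →
  ¬? (j₁ ≟ j₂) ×-dec any? λ u → incident? u (E j₁) ×-dec incident? u (E j₂)
  where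
  incident? : ∀ u e → Dec (Incident u e)
  incident? u e = ≡-dec _≟_ (proj₁ e) (just u) ⊎-dec ≡-dec _≟_ (proj₂ e) (just u)

¬SharedEndpoint⇒Balanced : (E : Vector (Edge m) n) → ¬ SharedEndpoint E → Balanced E
¬SharedEndpoint⇒Balanced E none i =
  ℕₚ.≤-trans (rowSum-unique (tails E) i (unique inj₁)) (s≤s z≤n) ,
  ℕₚ.≤-trans (rowSum-unique (heads E) i (unique inj₂)) (s≤s z≤n)
  where
  unique : ∀ {c : Choice _ _} → (∀ {j} → c j ≡ just i → Incident i (E j)) →
           ∀ j₁ j₂ → c j₁ ≡ just i → c j₂ ≡ just i → j₁ ≡ j₂
  unique incident j₁ j₂ c₁ c₂ with j₁ ≟ j₂
  ... | yes j₁≡j₂ = j₁≡j₂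
  ... | no  j₁≢j₂ = ⊥-elim (none (j₁ , j₂ , j₁≢j₂ , i , incident c₁ , incident c₂))

ends : Edge m → ℕ
ends (p , q) = #just p + #just q

ends-orient : ∀ τ (e : Edge m) → ends (orient τ e) ≡ ends e
ends-orient false e = refl
ends-orient true  e = ℕₚ.+-comm (#just (proj₂ e)) _

totalEnds : Vector (Edge m) n → ℕ
totalEnds E = sum (ends ∘ E)

-- Routing the edge {a, b} through u adds one tail and one head at row u and changes nothing else.
Balanced-unsplit : {F F′ : Vector (Edge m) n} {j₁ j₂ : Fin n} {u : Fin m} {a b : Maybe (Fin m)} →
  j₁ ≢ j₂ → (∀ k → k ≢ j₁ → k ≢ j₂ → F k ≡ F′ k) →
  F j₁ ≡ (a , just u) → F j₂ ≡ (just u , b) → F′ j₁ ≡ (a , b) → F′ j₂ ≡ (nothing , nothing) →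
  Balanced F′ → Balanced F
Balanced-unsplit {m} {F = F} {F′} {j₁} {j₂} {u} {a} {b} j₁≢j₂ agree F₁ F₂ F′₁ F′₂ balanced′ i =
  shift (proj₁ (balanced′ i)) tails≡ heads≡ , shift (proj₂ (balanced′ i)) heads≡ tails≡
  where
  d : ℕ
  d = hits i (just u)
  shift : ∀ {x y x′ y′} → x′ ℕ.≤ suc y′ → x ≡ d + x′ → y ≡ d + y′ → x ℕ.≤ suc y
  shift {x′ = x′} {y′} x′≤ refl refl = subst (d + x′ ℕ.≤_) (ℕₚ.+-suc d y′) (ℕₚ.+-monoʳ-≤ d x′≤)
  pair : (Edge m → Maybe (Fin m)) → Edge m → Edge m → ℕ
  pair π e₁ e₂ = hits i (π e₁) + hits i (π e₂)
  row≡ : (π : Edge m → Maybe (Fin m)) →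
         pair π (a , just u) (just u , b) ≡ d + pair π (a , b) (nothing , nothing) →
         rowSum (π ∘ F) i ≡ d + rowSum (π ∘ F′) i
  row≡ π local = sum-change₂ (hits i ∘ π ∘ F) (hits i ∘ π ∘ F′) d j₁≢j₂
    (λ k k≢j₁ k≢j₂ → cong (hits i ∘ π) (agree k k≢j₁ k≢j₂)) (begin
      pair π (F j₁) (F j₂)                    ≡⟨ cong₂ (pair π) F₁ F₂ ⟩
      pair π (a , just u) (just u , b)        ≡⟨ local ⟩
      d + pair π (a , b) (nothing , nothing)  ≡⟨ cong₂ (λ x y → d + pair π x y) F′₁ F′₂ ⟨
      d + pair π (F′ j₁) (F′ j₂)              ∎)
    where open ≡-Reasoning
  tails≡ : rowSum (tails F) i ≡ d + rowSum (tails F′) i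
  tails≡ = row≡ proj₁ (comm-identity (hits i a) d)
    where
    comm-identity : ∀ x y → x + y ≡ y + (x + 0)
    comm-identity = solve-∀
  heads≡ : rowSum (heads F) i ≡ d + rowSum (heads F′) i
  heads≡ = row≡ proj₂ (cong (λ x → d + x) (sym (ℕₚ.+-identityʳ (hits i b))))

Balanced-unsplit-orient : {F F′ : Vector (Edge m) n} {j₁ j₂ : Fin n} {u : Fin m} {a b : Maybe (Fin m)} →
  ∀ s → j₁ ≢ j₂ → (∀ k → k ≢ j₁ → k ≢ j₂ → F k ≡ F′ k) →
  F j₁ ≡ orient s (a , just u) → F j₂ ≡ orient s (just u , b) →
  F′ j₁ ≡ orient s (a , b) → F′ j₂ ≡ (nothing , nothing) →
  Balanced F′ → Balanced F
Balanced-unsplit-orient false = Balanced-unsplit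
Balanced-unsplit-orient {F = F} {F′} true j₁≢j₂ agree F₁ F₂ F′₁ F′₂ balanced′ =
  Balanced-reverse {F = swap ∘ F} (Balanced-unsplit {F = swap ∘ F} {swap ∘ F′} j₁≢j₂
    (λ k k≢j₁ k≢j₂ → cong swap (agree k k≢j₁ k≢j₂))
    (cong swap F₁) (cong swap F₂) (cong swap F′₁) (cong swap F′₂) (Balanced-reverse {F = F′} balanced′))

splitOff : Vector (Edge m) n → Fin n → Maybe (Fin m) → Fin n → Maybe (Fin m) → Vector (Edge m) n
splitOff E j₁ a j₂ b = update₂ E j₁ (a , b) j₂ (nothing , nothing)

module _ (E : Vector (Edge m) n) {j₁ j₂ : Fin n} {u : Fin m} {a b : Maybe (Fin m)} (j₁≢j₂ : j₁ ≢ j₂)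
         {τ₁ τ₂ : Bool} (e₁ : orient τ₁ (E j₁) ≡ (just u , a)) (e₂ : orient τ₂ (E j₂) ≡ (just u , b))
         where

  private
    E′ : Vector (Edge m) n
    E′ = splitOff E j₁ a j₂ b

  splitOff-totalEnds : totalEnds E ≡ 2 + totalEnds E′
  splitOff-totalEnds = sum-change₂ _ _ 2 j₁≢j₂
    (λ k k≢j₁ k≢j₂ → cong ends (sym (update₂-minimal E _ _ k k≢j₁ k≢j₂))) (begin
      ends (E j₁) + ends (E j₂)                   ≡⟨ cong₂ _+_ (ends-via e₁) (ends-via e₂) ⟩
      suc (#just a) + suc (#just b)               ≡⟨ two+ (#just a) (#just b) ⟩
      2 + (ends (a , b) + ends {m} (nothing , nothing))
        ≡⟨ cong₂ (λ x y → 2 + (ends x + ends y)) (update₂-updates₁ E _ _ j₁≢j₂) (update₂-updates₂ E _ _) ⟨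
      2 + (ends (E′ j₁) + ends (E′ j₂))           ∎)
    where
    open ≡-Reasoning
    ends-via : ∀ {τ e c} → orient τ e ≡ (just u , c) → ends e ≡ suc (#just c)
    ends-via {τ} {e} eq = trans (sym (ends-orient τ e)) (cong ends eq)
    two+ : ∀ x y → suc x + suc y ≡ 2 + (x + y + 0)
    two+ = solve-∀

  splitOff-smaller : totalEnds E′ < totalEnds E
  splitOff-smaller = subst (totalEnds E′ <_) (sym splitOff-totalEnds) (ℕₚ.m<n+m (totalEnds E′) (s≤s z≤n))

  splitOff-lift : ∀ σ′ → Balanced (oriented σ′ E′) → ∃ λ σ → Balanced (oriented σ E)
  splitOff-lift σ′ balanced′ = σ , Balanced-unsplit-orient s j₁≢j₂ agree F₁ F₂ F′₁ F′₂ balanced′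
    where
    open ≡-Reasoning
    s : Bool
    s = σ′ j₁
    -- The two old edges are oriented to traverse a – u – b in the direction s gives {a, b}.
    σ : Fin n → Bool
    σ = update₂ σ′ j₁ (τ₁ xor not s) j₂ (τ₂ xor s)
    F₁ : orient (σ j₁) (E j₁) ≡ orient s (a , just u)
    F₁ = begin
      orient (σ j₁) (E j₁)               ≡⟨ cong (λ t → orient t (E j₁)) (update₂-updates₁ σ′ _ _ j₁≢j₂) ⟩
      orient (τ₁ xor not s) (E j₁)       ≡⟨ orient-xor τ₁ (not s) (E j₁) ⟨
      orient (not s) (orient τ₁ (E j₁))  ≡⟨ cong (orient (not s)) e₁ ⟩
      orient (not s) (just u , a)        ≡⟨ orient-not s (just u , a) ⟩
      orient s (a , just u)              ∎
    F₂ : orient (σ j₂) (E j₂) ≡ orient s (just u , b)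
    F₂ = begin
      orient (σ j₂) (E j₂)          ≡⟨ cong (λ t → orient t (E j₂)) (update₂-updates₂ σ′ _ _) ⟩
      orient (τ₂ xor s) (E j₂)      ≡⟨ orient-xor τ₂ s (E j₂) ⟨
      orient s (orient τ₂ (E j₂))   ≡⟨ cong (orient s) e₂ ⟩
      orient s (just u , b)         ∎
    F′₁ : orient s (E′ j₁) ≡ orient s (a , b)
    F′₁ = cong (orient s) (update₂-updates₁ E _ _ j₁≢j₂)
    F′₂ : orient (σ′ j₂) (E′ j₂) ≡ (nothing , nothing)
    F′₂ = trans (cong (orient (σ′ j₂)) (update₂-updates₂ E _ _)) (orient-empty (σ′ j₂))
    agree : ∀ k → k ≢ j₁ → k ≢ j₂ → orient (σ k) (E k) ≡ orient (σ′ k) (E′ k)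
    agree k k≢j₁ k≢j₂ =
      cong₂ orient (update₂-minimal σ′ _ _ k k≢j₁ k≢j₂) (sym (update₂-minimal E _ _ k k≢j₁ k≢j₂))

balance-acc : (E : Vector (Edge m) n) → Acc _<_ (totalEnds E) → ∃ λ σ → Balanced (oriented σ E)
balance-acc E (acc smaller) with sharedEndpoint? E
... | no none = const false , ¬SharedEndpoint⇒Balanced E none
... | yes (j₁ , j₂ , j₁≢j₂ , u , inc₁ , inc₂)
  with incident⇒orient (E j₁) inc₁ | incident⇒orient (E j₂) inc₂
... | τ₁ , a , e₁ | τ₂ , b , e₂ =
  let σ′ , balanced′ = balance-acc _ (smaller (splitOff-smaller E j₁≢j₂ e₁ e₂))
  in splitOff-lift E j₁≢j₂ e₁ e₂ σ′ balanced′

balance : (E : Vector (Edge m) n) → ∃ λ σ → Balanced (oriented σ E)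
balance E = balance-acc E (<-wellFounded (totalEnds E))

orient-preserves-sum : (g : Maybe (Fin m) → ℕ) (τ : Bool) (e : Edge m) →
                       g (proj₁ (orient τ e)) + g (proj₂ (orient τ e)) ≡ g (proj₁ e) + g (proj₂ e)
orient-preserves-sum g false e = refl
orient-preserves-sum g true  e = ℕₚ.+-comm (g (proj₂ e)) _

oriented-preserves-sum : (g : Maybe (Fin m) → ℕ) (σ : Fin n → Bool) (E : Vector (Edge m) n) →
  sum (g ∘ tails (oriented σ E)) + sum (g ∘ heads (oriented σ E)) ≡ sum (g ∘ tails E) + sum (g ∘ heads E)
oriented-preserves-sum g σ E = begin
  sum (g ∘ tails (oriented σ E)) + sum (g ∘ heads (oriented σ E))
    ≡⟨ ∑-distrib-+ (g ∘ tails (oriented σ E)) (g ∘ heads (oriented σ E)) ⟨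
  sum (λ j → g (proj₁ (oriented σ E j)) + g (proj₂ (oriented σ E j)))
    ≡⟨ sum-cong-≗ (λ j → orient-preserves-sum g (σ j) (E j)) ⟩
  sum (λ j → g (proj₁ (E j)) + g (proj₂ (E j)))                  ≡⟨ ∑-distrib-+ (g ∘ tails E) (g ∘ heads E) ⟩
  sum (g ∘ tails E) + sum (g ∘ heads E)                            ∎
  where open ≡-Reasoning

module _ {A : Matrix01 m n} {P Q : Choice m n} (onesP : ChoosesOnes A P) (onesQ : ChoosesOnes A Q)
         (σ : Fin n → Bool) where

  ChoosesOnes-tails : ChoosesOnes A (tails (oriented σ (zip P Q)))
  ChoosesOnes-tails j with σ j
  ... | false = onesP j
  ... | true  = onesQ j

  ChoosesOnes-heads : ChoosesOnes A (heads (oriented σ (zip P Q)))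
  ChoosesOnes-heads j with σ j
  ... | false = onesQ j
  ... | true  = onesP j

≤-half : ∀ {r s t} → r ℕ.≤ suc s → r + s ℕ.≤ t + t → r ℕ.≤ t
≤-half {r} {s} {t} r≤1+s r+s≤t+t with r ℕ.≤? t
... | yes r≤t = r≤t
... | no  r≰t = ⊥-elim (ℕₚ.<⇒≱ (ℕₚ.+-mono-<-≤ t<r (ℕₚ.≤-pred (ℕₚ.≤-trans t<r r≤1+s))) r+s≤t+t)
  where
  t<r : t < r
  t<r = ℕₚ.≰⇒> r≰t

rebalance : ∀ {k} {A : Matrix01 m n} {P Q : Choice m n} →
  ValidChoice k A P → ValidChoice (suc (suc k)) A Q →
  ∃₂ λ R S → ValidChoice (suc k) A R × ValidChoice (suc k) A S × size R + size S ≡ size P + size Q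
rebalance {k = k} {P = P} {Q} (onesP , rowsP) (onesQ , rowsQ) =
  tails F , heads F ,
  (ChoosesOnes-tails onesP onesQ σ , tails-bounded) ,
  (ChoosesOnes-heads onesP onesQ σ , heads-bounded) ,
  sizes
  where
  σ : Fin _ → Bool
  σ = proj₁ (balance (zip P Q))
  F : Vector (Edge _) _
  F = oriented σ (zip P Q)
  balanced : Balanced F
  balanced = proj₂ (balance (zip P Q))
  total : ∀ i → rowSum (tails F) i + rowSum (heads F) i ℕ.≤ suc k + suc k
  total i = begin
    rowSum (tails F) i + rowSum (heads F) i  ≡⟨ oriented-preserves-sum (hits i) σ (zip P Q) ⟩
    rowSum P i + rowSum Q i                  ≡⟨ cong₂ _+_ (rowCount≡rowSum P i) (rowCount≡rowSum Q i) ⟨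
    rowCount P i + rowCount Q i              ≤⟨ ℕₚ.+-mono-≤ (rowsP i) (rowsQ i) ⟩
    k + suc (suc k)                          ≡⟨ ℕₚ.+-suc k (suc k) ⟩
    suc k + suc k                            ∎
    where open ℕₚ.≤-Reasoning
  tails-bounded : ∀ i → rowCount (tails F) i ℕ.≤ suc k
  tails-bounded i = subst (ℕ._≤ suc k) (sym (rowCount≡rowSum (tails F) i))
    (≤-half (proj₁ (balanced i)) (total i))
  heads-bounded : ∀ i → rowCount (heads F) i ℕ.≤ suc k
  heads-bounded i = subst (ℕ._≤ suc k) (sym (rowCount≡rowSum (heads F) i))
    (≤-half (proj₂ (balanced i))
            (subst (ℕ._≤ suc k + suc k) (ℕₚ.+-comm (rowSum (tails F) i) _) (total i)))
  sizes : size (tails F) + size (heads F) ≡ size P + size Q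
  sizes = begin
    size (tails F) + size (heads F)                    ≡⟨ cong₂ _+_ (size≡sum (tails F)) (size≡sum (heads F)) ⟩
    sum (#just ∘ tails F) + sum (#just ∘ heads F)      ≡⟨ oriented-preserves-sum #just σ (zip P Q) ⟩
    sum (#just ∘ P) + sum (#just ∘ Q)                  ≡⟨ cong₂ _+_ (size≡sum P) (size≡sum Q) ⟨
    size P + size Q                                    ∎
    where open ≡-Reasoning

m+o≤n+n⇒o-n≤n-m : ∀ a b c → a + c ℕ.≤ b + b → (+ c) - (+ b) ≤ (+ b) - (+ a)
m+o≤n+n⇒o-n≤n-m a b c a+c≤b+b = begin
  (+ c) - (+ b)      ≡⟨ ℤₚ.m-n≡m⊖n c b ⟩
  c ⊖ b              ≡⟨ ℤₚ.+-cancelˡ-⊖ a c b ⟨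
  (a + c) ⊖ (a + b)  ≤⟨ ℤₚ.⊖-monoˡ-≤ (a + b) a+c≤b+b ⟩
  (b + b) ⊖ (a + b)  ≡⟨ cong ((b + b) ⊖_) (ℕₚ.+-comm a b) ⟩
  (b + b) ⊖ (b + a)  ≡⟨ ℤₚ.+-cancelˡ-⊖ b b a ⟩
  b ⊖ a              ≡⟨ ℤₚ.m-n≡m⊖n b a ⟨
  (+ b) - (+ a)      ∎
  where open ℤₚ.≤-Reasoning

proposition2p3 : ∀ (m n : ℕ) (A : Matrix01 m n) (k : ℕ) (a b c : ℕ) →
    IsTermRank k A a → IsTermRank (suc k) A b → IsTermRank (suc (suc k)) A c →
    (+ c) - (+ b) ≤ (+ b) - (+ a)
proposition2p3 m n A k a b c ((P , validP , refl) , _) (_ , maximal) ((Q , validQ , refl) , _) =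
  let R , S , validR , validS , sizes = rebalance validP validQ
  in m+o≤n+n⇒o-n≤n-m (size P) b (size Q)
       (subst (ℕ._≤ b + b) sizes (ℕₚ.+-mono-≤ (maximal R validR) (maximal S validS)))
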